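{- Let $S$ be a finite set of positive integers with largest element $k$, and suppose the smallest positive integer not in $S$ is $k-c$ for some integer $c>0$. Let $(a_n)_{n\ge1}$ be the $S$-LID sequence, with the convention $a_j=0$ for $j\le0$. Let $d$ be a positive integer and $n$ an integer. Suppose that \[ a_{n+1}+a_n > a_{n+c}+a_{n-d}, \qquad a_{n-k+1}+a_{n-k} > a_{n-k+c}+a_{n-k-d}, \] and that $a_{m+1}=a_m+a_{m-k}$ holds for each $m\in\{n+1,\ n,\ n+c,\ n-d\}$. Then \[ a_{n+2}+a_{n+1} > a_{n+1+c}+a_{n+1-d}. \]
   Context: For a set $S$ of positive integers, the $S$-legal index difference ($S$-LID) sequence $(a_n)_{n\ge 1}$ is defined recursively: for each positive integer $n$, $a_n$ is the smallest positive integer that cannot be written as $\sum_{\ell\in L} a_\ell$ for some set $L \subseteq \{1,\dots,n-1\}$ such that $|i-j|\notin S$ for all $i,j\in L$ (the empty sum is $0$). -}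

module Defs where

open import Data.Nat using (ℕ; zero; suc; _<_; _≤_; ∣_-_∣)
open import Data.Integer using (ℤ; +_; -[1+_])
open import Data.List using (List; map)
open import Data.Nat.ListAction using (sum)
open import Data.List.Membership.Propositional using (_∈_; _∉_)
open import Data.List.Relation.Unary.All using (All)
open import Data.List.Relation.Unary.Unique.Propositional using (Unique)
open import Data.Product using (Σ; _×_)
open import Relation.Binary.PropositionalEquality using (_≡_)
open import Relation.Nullary using (¬_)

-- A finite set S of positive integers is given as a list (duplicates harmless).
-- x can be written as Σ_{ℓ ∈ L} a_ℓ for a set L ⊆ {1,…,n-1} with |i-j| ∉ S for all i,j ∈ L.
Representable : List ℕ → (ℕ → ℕ) → ℕ → ℕ → Set
Representable S a x n =
  Σ (List ℕ) λ L →
    Unique L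
    × All (λ i → 1 ≤ i × i < n) L
    × (∀ {i j} → i ∈ L → j ∈ L → ∣ i - j ∣ ∉ S)
    × sum (map a L) ≡ x

-- a is the S-LID sequence (on indices n ≥ 1; the value a 0 is irrelevant):
-- a n is the smallest positive integer not representable using indices < n.
IsLID : List ℕ → (ℕ → ℕ) → Set
IsLID S a = ∀ n → 1 ≤ n →
  (1 ≤ a n)
  × ¬ Representable S a (a n) n
  × (∀ m → 1 ≤ m → m < a n → Representable S a m n)

ext : (ℕ → ℕ) → ℤ → ℕ
ext a (+ zero) = 0
ext a (+ suc m) = a (suc m)
ext a -[1+ m ] = 0

{-# OPTIONS --safe #-}
module Submission where

-- Summing the two hypothesised inequalities and substituting the recurrence
-- a_{m+1} = a_m + a_{m-k} at the four indices turns the left-hand side into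
-- a_{n+1+c} + a_{n+1-d} and the right-hand side into a_{n+2} + a_{n+1}.

open import Defs
open import Data.Nat using (ℕ; _<_; _≤_; _>_; _∸_; _+_)
open import Data.Integer using (ℤ; +_; -_) renaming (_+_ to _+ℤ_; _-_ to _-ℤ_)
open import Data.List using (List)
open import Data.List.Membership.Propositional using (_∈_; _∉_)
open import Data.List.Relation.Unary.All using (All)
open import Relation.Binary.PropositionalEquality using (_≡_; sym; cong; cong₂; subst₂)
import Data.Nat.Properties as ℕ
import Data.Integer.Properties as ℤ
open import Algebra.Properties.CommutativeSemigroup ℕ.+-commutativeSemigroup
  using (interchange)
open import Algebra.Properties.CommutativeSemigroup ℤ.+-commutativeSemigroup
  using (xy∙z≈xz∙y)

+-<-interchange : ∀ y z r s u v p q →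
  y + z < u + v → r + s < p + q → y + r + (z + s) < u + p + (v + q)
+-<-interchange y z r s u v p q y+z<u+v r+s<p+q =
  subst₂ _<_ (interchange y z r s) (interchange u v p q)
    (ℕ.+-mono-<-≤ y+z<u+v (ℕ.<⇒≤ r+s<p+q))

ext-shift-comm : ∀ (a : ℕ → ℕ) (n : ℤ) (x y : ℤ) → ext a (n +ℤ x +ℤ y) ≡ ext a (n +ℤ y +ℤ x)
ext-shift-comm a n x y = cong (ext a) (xy∙z≈xz∙y n x y)

lemma3p5 : (S : List ℕ) (a : ℕ → ℕ) (k c d : ℕ) (n : ℤ) →
    All (λ s → 1 ≤ s) S → k ∈ S → All (λ s → s ≤ k) S →
    0 < c → c < k → (k ∸ c) ∉ S → (∀ m → 1 ≤ m → m < k ∸ c → m ∈ S) →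
    IsLID S a → 0 < d →
    ext a (n +ℤ + 1) + ext a n > ext a (n +ℤ + c) + ext a (n -ℤ + d) →
    ext a (n -ℤ + k +ℤ + 1) + ext a (n -ℤ + k) > ext a (n -ℤ + k +ℤ + c) + ext a (n -ℤ + k -ℤ + d) →
    ext a (n +ℤ + 1 +ℤ + 1) ≡ ext a (n +ℤ + 1) + ext a (n +ℤ + 1 -ℤ + k) →
    ext a (n +ℤ + 1) ≡ ext a n + ext a (n -ℤ + k) →
    ext a (n +ℤ + c +ℤ + 1) ≡ ext a (n +ℤ + c) + ext a (n +ℤ + c -ℤ + k) →
    ext a (n -ℤ + d +ℤ + 1) ≡ ext a (n -ℤ + d) + ext a (n -ℤ + d -ℤ + k) →
    ext a (n +ℤ + 2) + ext a (n +ℤ + 1) > ext a (n +ℤ + 1 +ℤ + c) + ext a (n +ℤ + 1 -ℤ + d)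
lemma3p5 S a k c d n _ _ _ _ _ _ _ _ _ ineq-n ineq-n-k rec-n+1 rec-n rec-n+c rec-n-d =
  begin-strict
    A (n +ℤ + 1 +ℤ + c) + A (n +ℤ + 1 -ℤ + d)
      ≡⟨ cong₂ _+_ (ext-shift-comm a n (+ 1) (+ c)) (ext-shift-comm a n (+ 1) (- + d)) ⟩
    A (n +ℤ + c +ℤ + 1) + A (n -ℤ + d +ℤ + 1)
      ≡⟨ cong₂ _+_ rec-n+c rec-n-d ⟩
    A (n +ℤ + c) + A (n +ℤ + c -ℤ + k) + (A (n -ℤ + d) + A (n -ℤ + d -ℤ + k))
      <⟨ +-<-interchange
            (A (n +ℤ + c)) (A (n -ℤ + d)) (A (n +ℤ + c -ℤ + k)) (A (n -ℤ + d -ℤ + k))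
            (A (n +ℤ + 1)) (A n) (A (n +ℤ + 1 -ℤ + k)) (A (n -ℤ + k))
            ineq-n ineq-n-k′ ⟩
    A (n +ℤ + 1) + A (n +ℤ + 1 -ℤ + k) + (A n + A (n -ℤ + k))
      ≡⟨ cong₂ _+_ (sym rec-n+1) (sym rec-n) ⟩
    A (n +ℤ + 1 +ℤ + 1) + A (n +ℤ + 1)
      ≡⟨ cong (λ m → A m + A (n +ℤ + 1)) (ℤ.+-assoc n (+ 1) (+ 1)) ⟩
    A (n +ℤ + 2) + A (n +ℤ + 1)
  ∎
  where
  open ℕ.≤-Reasoning
  A : ℤ → ℕ
  A = ext a
  ineq-n-k′ : A (n +ℤ + c -ℤ + k) + A (n -ℤ + d -ℤ + k) < A (n +ℤ + 1 -ℤ + k) + A (n -ℤ + k)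
  ineq-n-k′ = subst₂ _<_
    (cong₂ _+_ (ext-shift-comm a n (- + k) (+ c)) (ext-shift-comm a n (- + k) (- + d)))
    (cong (_+ A (n -ℤ + k)) (ext-shift-comm a n (- + k) (+ 1)))
    ineq-n-k
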